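{- Let $m\geq 3$ and let $G=S(2,1^{m-1})$, i.e. the tree on the $m+2$ vertices $o,x_1,\dots,x_m,y$ whose edges are $ox_1,\dots,ox_m$ and $x_1y$. Let $H$ be a distance-balanced graph containing $G$ as a spanning subgraph. Then $\mathrm{diam}(H)\leq 2$, and hence $H$ is $r$-regular for some integer $r$ with $m\leq r\leq m+1$.
   Context: All graphs are finite and simple. For vertices $u,v$ of a graph $H$, $d_H(u,v)$ is the length of a shortest $u$–$v$ path, and $\mathrm{diam}(H)=\max_{u,v} d_H(u,v)$. For an edge $xy$ of $H$, $W^H_{xy}=\{u\in V(H): d_H(u,x)<d_H(u,y)\}$. A graph $H$ is distance-balanced if $|W^H_{xy}|=|W^H_{yx}|$ for every edge $xy$ of $H$. A starlike tree is a tree with exactly one vertex of degree greater than two; $S(n_1^{\alpha_1},\dots,n_k^{\alpha_k})$ denotes the starlike tree in which deleting the central vertex leaves $\alpha_i$ paths with $n_i$ vertices for each $i$. -}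

module Defs where

open import Data.Bool using (Bool; true; false; _∧_; _∨_; if_then_else_)
open import Data.Nat using (ℕ; zero; suc; _+_; _⊔_; _<ᵇ_)
open import Data.Fin using (Fin; zero; suc; _≟_)
open import Data.List using (List; foldr; map; allFin)
open import Relation.Nullary.Decidable using (⌊_⌋)
open import Relation.Binary.PropositionalEquality using (_≡_)

record Graph (n : ℕ) : Set where
  field
    adj   : Fin n → Fin n → Bool
    sym   : ∀ u v → adj u v ≡ adj v u
    irrefl : ∀ u → adj u u ≡ false
open Graph public

anyV : ∀ {n} → (Fin n → Bool) → Bool
anyV {n} p = foldr (λ v b → p v ∨ b) false (allFin n)

countV : ∀ {n} → (Fin n → Bool) → ℕ
countV {n} p = foldr (λ v c → if p v then suc c else c) zero (allFin n)

reach : ∀ {n} → Graph n → ℕ → Fin n → Fin n → Bool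
reach H zero    u v = ⌊ u ≟ v ⌋
reach H (suc k) u v = reach H k u v ∨ anyV (λ w → reach H k u w ∧ adj H w v)

-- least b p = least k < b with p k ≡ true, or b if there is none
least : ℕ → (ℕ → Bool) → ℕ
least zero    p = zero
least (suc b) p = if p zero then zero else suc (least b (λ k → p (suc k)))

-- d_H(u,v): the length of a shortest u–v path (a shortest path has < n edges;
-- the value n is returned only if u and v lie in different components).
dist : ∀ {n} → Graph n → Fin n → Fin n → ℕ
dist {n} H u v = least n (λ k → reach H k u v)

diam : ∀ {n} → Graph n → ℕ
diam {n} H = foldr _⊔_ zero (map (λ u → foldr _⊔_ zero (map (λ v → dist H u v) (allFin n))) (allFin n))

Wsize : ∀ {n} → Graph n → Fin n → Fin n → ℕ
Wsize H x y = countV (λ u → dist H u x <ᵇ dist H u y)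

DistanceBalanced : ∀ {n} → Graph n → Set
DistanceBalanced H = ∀ x y → adj H x y ≡ true → Wsize H x y ≡ Wsize H y x

degree : ∀ {n} → Graph n → Fin n → ℕ
degree H v = countV (λ w → adj H v w)

-- The starlike tree G = S(2,1^{m-1}) on vertex set Fin (m + 2):
-- o = vertex 0, x_i = vertex i (1 ≤ i ≤ m), y = vertex m+1.
-- Edges: o x_i (1 ≤ i ≤ m) and x_1 y.
isO : ∀ {m} → Fin (suc (suc m)) → Bool
isO zero    = true
isO (suc _) = false

isX1 : ∀ {m} → Fin (suc (suc m)) → Bool
isX1 (suc zero) = true
isX1 _          = false

isY : ∀ {m} → Fin (suc (suc m)) → Bool
isY {m} v = ⌊ v ≟ Data.Fin.fromℕ (suc m) ⌋

isX : ∀ {m} → Fin (suc (suc m)) → Bool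
isX v = if isO v then false else if isY v then false else true

adjG : ∀ {m} → Fin (suc (suc m)) → Fin (suc (suc m)) → Bool
adjG u v = (isO u ∧ isX v) ∨ (isX u ∧ isO v) ∨ (isX1 u ∧ isY v) ∨ (isY u ∧ isX1 v)

ContainsS21 : ∀ {m} → Graph (suc (suc m)) → Set
ContainsS21 H = ∀ u v → adjG u v ≡ true → adj H u v ≡ true

-- The centre o is adjacent to every vertex except y, and y reaches o through x₁, so a
-- pair at distance ≥ 3 must be y and some neighbour b of o.  But then W_bo ⊆ {b} while
-- W_ob ⊇ {o, y}, contradicting balance on the edge ob; hence diam H ≤ 2.  In diameter 2,
-- W_ab is N(a) ∖ N(b) with b exchanged for a, so |W_ab| = |W_ba| forces deg a = deg b
-- along every edge; H is connected, hence regular, of the degree of o, which is m or m + 1.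
module Submission where

open import Defs
open import Data.Bool using (Bool; true; false; not; _∧_; _∨_; if_then_else_)
open import Data.Bool.Properties using (∧-comm; ∨-zeroʳ; ¬-not; T-≡)
open import Data.Fin using (Fin; zero; suc; _≟_; fromℕ; toℕ)
open import Data.Fin.Properties using (toℕ-fromℕ) renaming (suc-injective to Fin-suc-injective)
open import Data.List using (List; []; _∷_; foldr; map; allFin; tabulate)
open import Data.List.Properties using (foldr-map; map-tabulate)
open import Data.Nat using (ℕ; zero; suc; _+_; _≤_; _<_; _<ᵇ_; _⊔_; z≤n; s≤s; _≤′_; ≤′-refl; ≤′-step)
open import Data.Nat.Properties
  using ( ≤-refl; ≤-trans; ≤-antisym; ≤-pred; ≤⇒≤′; n≤0⇒n≡0; 1+n≰n; <-asym; <⇒≱; <⇒≢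
        ; <⇒<ᵇ; <ᵇ⇒<; suc-injective; +-identityʳ; +-mono-≤; +-cancelˡ-≡; +-cancelʳ-≡; ⊔-lub
        ; +-commutativeSemigroup; module ≤-Reasoning )
open import Algebra.Properties.CommutativeSemigroup +-commutativeSemigroup using (interchange)
open import Data.Product using (Σ; _×_; _,_; ∃-syntax)
open import Data.Sum using (_⊎_; inj₁; inj₂)
open import Function using (_∘_; id; Equivalence)
open import Relation.Nullary using (¬_; Dec; yes; no; contradiction)
open import Relation.Nullary.Decidable using (⌊_⌋; ⌊⌋-map′; isYes≗does; dec-true; dec-false)
open import Relation.Binary.PropositionalEquality
  using (_≡_; _≢_; refl; trans; cong; cong₂; module ≡-Reasoning)
  renaming (sym to ≡-sym)

indicator : Bool → ℕ
indicator true  = 1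
indicator false = 0

<⇒<ᵇ≡true : ∀ {m n} → m < n → (m <ᵇ n) ≡ true
<⇒<ᵇ≡true m<n = Equivalence.to T-≡ (<⇒<ᵇ m<n)

<ᵇ≡true⇒< : ∀ {m n} → (m <ᵇ n) ≡ true → m < n
<ᵇ≡true⇒< {m} {n} m<ᵇn = <ᵇ⇒< m n (Equivalence.from T-≡ m<ᵇn)

foldr-allFin-suc : ∀ {A : Set} {n} (f : Fin (suc n) → A → A) (z : A) →
  foldr f z (allFin (suc n)) ≡ f zero (foldr (f ∘ suc) z (allFin n))
foldr-allFin-suc {n = n} f z = cong (f zero) (begin
  foldr f z (tabulate suc)        ≡⟨ cong (foldr f z) (≡-sym (map-tabulate id suc)) ⟩
  foldr f z (map suc (allFin n))  ≡⟨ foldr-map f suc z (allFin n) ⟩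
  foldr (f ∘ suc) z (allFin n)    ∎)
  where open ≡-Reasoning

countV-suc : ∀ {n} (p : Fin (suc n) → Bool) → countV p ≡ indicator (p zero) + countV (p ∘ suc)
countV-suc p = trans (foldr-allFin-suc (λ v c → if p v then suc c else c) zero) (if-suc (p zero))
  where
  if-suc : ∀ b {c} → (if b then suc c else c) ≡ indicator b + c
  if-suc true  = refl
  if-suc false = refl

anyV-suc : ∀ {n} (p : Fin (suc n) → Bool) → anyV p ≡ p zero ∨ anyV (p ∘ suc)
anyV-suc p = foldr-allFin-suc (λ v b → p v ∨ b) false

anyV-intro : ∀ {n} (p : Fin n → Bool) w → p w ≡ true → anyV p ≡ true
anyV-intro p zero    pw = trans (anyV-suc p) (cong (_∨ anyV (p ∘ suc)) pw)
anyV-intro p (suc w) pw =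
  trans (anyV-suc p) (trans (cong (p zero ∨_) (anyV-intro (p ∘ suc) w pw)) (∨-zeroʳ (p zero)))

anyV-elim : ∀ {n} (p : Fin n → Bool) → anyV p ≡ true → ∃[ w ] p w ≡ true
anyV-elim {zero}  p ()
anyV-elim {suc n} p any with p zero in p0 | trans (≡-sym (anyV-suc p)) any
... | true  | _   = zero , p0
... | false | any′ with anyV-elim (p ∘ suc) any′
...   | w , pw = suc w , pw

indicator-mono : ∀ {a b} → (a ≡ true → b ≡ true) → indicator a ≤ indicator b
indicator-mono {false}         _ = z≤n
indicator-mono {true} {true}   _ = ≤-refl
indicator-mono {true} {false} a⇒b with a⇒b refl
... | ()

countV-mono : ∀ {n} {p q : Fin n → Bool} → (∀ u → p u ≡ true → q u ≡ true) → countV p ≤ countV q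
countV-mono {zero}          _   = z≤n
countV-mono {suc n} {p} {q} p⊆q rewrite countV-suc p | countV-suc q =
  +-mono-≤ (indicator-mono (p⊆q zero)) (countV-mono (p⊆q ∘ suc))

countV-cong : ∀ {n} {p q : Fin n → Bool} → (∀ u → p u ≡ q u) → countV p ≡ countV q
countV-cong p≗q = ≤-antisym (countV-mono (λ u → trans (≡-sym (p≗q u))))
                            (countV-mono (λ u → trans (p≗q u)))

countV-+-cong : ∀ {n} {p q r s : Fin n → Bool} →
  (∀ u → indicator (p u) + indicator (q u) ≡ indicator (r u) + indicator (s u)) →
  countV p + countV q ≡ countV r + countV s
countV-+-cong {zero}                  _ = refl
countV-+-cong {suc n} {p} {q} {r} {s} h = begin
  countV p + countV q
    ≡⟨ cong₂ _+_ (countV-suc p) (countV-suc q) ⟩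
  (indicator (p zero) + countV (p ∘ suc)) + (indicator (q zero) + countV (q ∘ suc))
    ≡⟨ interchange (indicator (p zero)) (countV (p ∘ suc)) (indicator (q zero)) (countV (q ∘ suc)) ⟩
  (indicator (p zero) + indicator (q zero)) + (countV (p ∘ suc) + countV (q ∘ suc))
    ≡⟨ cong₂ _+_ (h zero) (countV-+-cong (h ∘ suc)) ⟩
  (indicator (r zero) + indicator (s zero)) + (countV (r ∘ suc) + countV (s ∘ suc))
    ≡⟨ interchange (indicator (r zero)) (indicator (s zero)) (countV (r ∘ suc)) (countV (s ∘ suc)) ⟩
  (indicator (r zero) + countV (r ∘ suc)) + (indicator (s zero) + countV (s ∘ suc))
    ≡⟨ ≡-sym (cong₂ _+_ (countV-suc r) (countV-suc s)) ⟩
  countV r + countV s ∎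
  where open ≡-Reasoning

countV-false : ∀ {n} → countV {n} (λ _ → false) ≡ 0
countV-false {zero}  = refl
countV-false {suc n} = trans (countV-suc {n} (λ _ → false)) (countV-false {n})

countV-true : ∀ {n} → countV {n} (λ _ → true) ≡ n
countV-true {zero}  = refl
countV-true {suc n} = trans (countV-suc {n} (λ _ → true)) (cong suc (countV-true {n}))

countV-+ : ∀ {n} {p q r : Fin n → Bool} →
  (∀ u → indicator (p u) + indicator (q u) ≡ indicator (r u)) → countV p + countV q ≡ countV r
countV-+ {n} {p} {q} {r} h = begin
  countV p + countV q
    ≡⟨ countV-+-cong {s = λ _ → false} (λ u → trans (h u) (≡-sym (+-identityʳ _))) ⟩
  countV r + countV {n} (λ _ → false)
    ≡⟨ cong (countV r +_) (countV-false {n}) ⟩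
  countV r + 0
    ≡⟨ +-identityʳ _ ⟩
  countV r ∎
  where open ≡-Reasoning

countV-≟ : ∀ {n} (a : Fin n) → countV (λ u → ⌊ u ≟ a ⌋) ≡ 1
countV-≟ {suc n} zero    = trans (countV-suc {n} (λ u → ⌊ u ≟ zero ⌋)) (cong suc (countV-false {n}))
countV-≟ {suc n} (suc a) = begin
  countV (λ u → ⌊ u ≟ suc a ⌋)       ≡⟨ countV-suc (λ u → ⌊ u ≟ suc a ⌋) ⟩
  countV (λ u → ⌊ suc u ≟ suc a ⌋)   ≡⟨ countV-cong (λ u → ⌊⌋-map′ _ _ (u ≟ a)) ⟩
  countV (λ u → ⌊ u ≟ a ⌋)           ≡⟨ countV-≟ a ⟩
  1                                  ∎
  where open ≡-Reasoning

countV-pair : ∀ {n} {a b : Fin n} → a ≢ b → countV (λ u → ⌊ u ≟ a ⌋ ∨ ⌊ u ≟ b ⌋) ≡ 2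
countV-pair {a = a} {b} a≢b = trans (≡-sym (countV-+ disjoint)) (cong₂ _+_ (countV-≟ a) (countV-≟ b))
  where
  disjoint : ∀ u → indicator ⌊ u ≟ a ⌋ + indicator ⌊ u ≟ b ⌋ ≡ indicator (⌊ u ≟ a ⌋ ∨ ⌊ u ≟ b ⌋)
  disjoint u with u ≟ a | u ≟ b
  ... | yes refl | yes refl = contradiction refl a≢b
  ... | yes _    | no _     = refl
  ... | no _     | yes _    = refl
  ... | no _     | no _     = refl

countV-not : ∀ {n} (p : Fin n → Bool) → countV p + countV (not ∘ p) ≡ n
countV-not {n} p = trans (countV-+ (complement ∘ p)) (countV-true {n})
  where
  complement : ∀ b → indicator b + indicator (not b) ≡ indicator true
  complement true  = refl
  complement false = refl

countV-complement : ∀ {n} k (p : Fin (k + n) → Bool) → countV p ≡ k → countV (not ∘ p) ≡ n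
countV-complement k p p≡k =
  +-cancelˡ-≡ k _ _ (trans (cong (_+ countV (not ∘ p)) (≡-sym p≡k)) (countV-not p))

countV-split : ∀ {n} (p q : Fin n → Bool) →
  countV (λ u → p u ∧ q u) + countV (λ u → p u ∧ not (q u)) ≡ countV p
countV-split p q = countV-+ (λ u → split (p u) (q u))
  where
  split : ∀ a b → indicator (a ∧ b) + indicator (a ∧ not b) ≡ indicator a
  split true  true  = refl
  split true  false = refl
  split false _     = refl

least-≤ : ∀ b (p : ℕ → Bool) {k} → p k ≡ true → least b p ≤ k
least-≤ zero    p         _  = z≤n
least-≤ (suc b) p {k}     pk with p zero in p0
least-≤ (suc b) p {k}     pk | true  = z≤n
least-≤ (suc b) p {zero}  pk | false = contradiction (trans (≡-sym p0) pk) λ ()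
least-≤ (suc b) p {suc k} pk | false = s≤s (least-≤ b (p ∘ suc) pk)

≤-least : ∀ b (p : ℕ → Bool) {k} → k ≤ b → (∀ {j} → j < k → p j ≡ false) → k ≤ least b p
≤-least b       p {zero}  _         _       = z≤n
≤-least (suc b) p {suc k} (s≤s k≤b) below rewrite below (s≤s z≤n) =
  s≤s (≤-least b (p ∘ suc) k≤b (below ∘ s≤s))

module Walks {n} (H : Graph n) where

  adj-sym : ∀ {u v} → adj H u v ≡ true → adj H v u ≡ true
  adj-sym {u} {v} uv = trans (sym H v u) uv

  adj⇒≢ : ∀ {u v} → adj H u v ≡ true → u ≢ v
  adj⇒≢ {u} uv refl = contradiction (trans (≡-sym uv) (irrefl H u)) λ ()

  reach-zero : ∀ u → reach H 0 u u ≡ true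
  reach-zero u with u ≟ u
  ... | yes _   = refl
  ... | no  u≢u = contradiction refl u≢u

  reach-zero⁻¹ : ∀ {u v} → reach H 0 u v ≡ true → u ≡ v
  reach-zero⁻¹ {u} {v} r with u ≟ v
  reach-zero⁻¹ _  | yes u≡v = u≡v
  reach-zero⁻¹ () | no _

  reach-suc : ∀ {k u v} → reach H k u v ≡ true → reach H (suc k) u v ≡ true
  reach-suc {k} {u} {v} r = cong (_∨ anyV (λ w → reach H k u w ∧ adj H w v)) r

  reach-mono : ∀ {j k u v} → j ≤′ k → reach H j u v ≡ true → reach H k u v ≡ true
  reach-mono             ≤′-refl       = id
  reach-mono {k = suc k} (≤′-step j≤k) = reach-suc {k} ∘ reach-mono j≤k

  reach-step : ∀ {k u w v} → reach H k u w ≡ true → adj H w v ≡ true → reach H (suc k) u v ≡ true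
  reach-step {k} {u} {w} {v} uw wv =
    trans (cong (reach H k u v ∨_) (anyV-intro (λ x → reach H k u x ∧ adj H x v) w (cong₂ _∧_ uw wv)))
          (∨-zeroʳ (reach H k u v))

  reach-step⁻¹ : ∀ {k u v} → reach H (suc k) u v ≡ true →
    reach H k u v ≡ true ⊎ ∃[ w ] (reach H k u w ≡ true × adj H w v ≡ true)
  reach-step⁻¹ {k} {u} {v} r with reach H k u v
  ... | true  = inj₁ refl
  ... | false with anyV-elim (λ x → reach H k u x ∧ adj H x v) r
  ...   | w , uwv with reach H k u w in uw | adj H w v in wv | uwv
  ...     | true  | true  | _  = inj₂ (w , uw , wv)
  ...     | true  | false | ()
  ...     | false | _     | ()

  reach-one⁻¹ : ∀ {u v} → reach H 1 u v ≡ true → u ≡ v ⊎ adj H u v ≡ true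
  reach-one⁻¹ {u} {v} r with reach-step⁻¹ {0} {u} {v} r
  ... | inj₁ r₀             = inj₁ (reach-zero⁻¹ r₀)
  ... | inj₂ (w , r₀ , wv) with reach-zero⁻¹ {u} {w} r₀
  ...   | refl = inj₂ wv

  data Within₂ (u v : Fin n) : Set where
    equal            : u ≡ v → Within₂ u v
    adjacent         : adj H u v ≡ true → Within₂ u v
    common-neighbour : ∀ w → adj H u w ≡ true → adj H w v ≡ true → Within₂ u v

  within₂-sym : ∀ {u v} → Within₂ u v → Within₂ v u
  within₂-sym (equal u≡v)               = equal (≡-sym u≡v)
  within₂-sym (adjacent uv)             = adjacent (adj-sym uv)
  within₂-sym (common-neighbour w uw wv) = common-neighbour w (adj-sym wv) (adj-sym uw)

  within₂-through : ∀ {a u v} → u ≡ a ⊎ adj H a u ≡ true → v ≡ a ⊎ adj H a v ≡ true → Within₂ u v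
  within₂-through (inj₁ refl) (inj₁ refl) = equal refl
  within₂-through (inj₁ refl) (inj₂ av)   = adjacent av
  within₂-through (inj₂ au)   (inj₁ refl) = adjacent (adj-sym au)
  within₂-through (inj₂ au)   (inj₂ av)   = common-neighbour _ (adj-sym au) av

  degree-constant-within₂ : (∀ {a b} → adj H a b ≡ true → degree H a ≡ degree H b) →
    ∀ {u v} → Within₂ u v → degree H u ≡ degree H v
  degree-constant-within₂ along-edges (equal refl)               = refl
  degree-constant-within₂ along-edges (adjacent uv)              = along-edges uv
  degree-constant-within₂ along-edges (common-neighbour _ uw wv) =
    trans (along-edges uw) (along-edges wv)

  within₂⇒reach₂ : ∀ {u v} → Within₂ u v → reach H 2 u v ≡ true
  within₂⇒reach₂ {u} (equal refl)               = reach-suc {1} (reach-suc {0} (reach-zero u))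
  within₂⇒reach₂ {u} (adjacent uv)              = reach-suc {1} (reach-step {0} (reach-zero u) uv)
  within₂⇒reach₂ {u} (common-neighbour w uw wv) = reach-step {1} (reach-step {0} (reach-zero u) uw) wv

  reach₂⇒within₂ : ∀ {u v} → reach H 2 u v ≡ true → Within₂ u v
  reach₂⇒within₂ {u} {v} r with reach-step⁻¹ {1} {u} {v} r
  ... | inj₁ r₁ with reach-one⁻¹ r₁
  ...   | inj₁ u≡v = equal u≡v
  ...   | inj₂ uv  = adjacent uv
  reach₂⇒within₂ {u} r | inj₂ (w , r₁ , wv) with reach-one⁻¹ {u} {w} r₁
  ...   | inj₁ refl = adjacent wv
  ...   | inj₂ uw   = common-neighbour w uw wv

  within₂? : ∀ u v → Dec (Within₂ u v)
  within₂? u v with reach H 2 u v in r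
  ... | true  = yes (reach₂⇒within₂ r)
  ... | false = no λ w → contradiction (trans (≡-sym r) (within₂⇒reach₂ w)) λ ()

degree≤ : ∀ {n} (H : Graph (suc n)) a → degree H a ≤ n
degree≤ {n} H a = begin
  degree H a                    ≤⟨ countV-mono not-loop ⟩
  countV (λ u → not ⌊ u ≟ a ⌋)  ≡⟨ countV-complement 1 (λ u → ⌊ u ≟ a ⌋) (countV-≟ a) ⟩
  n                             ∎
  where
  open ≤-Reasoning
  not-loop : ∀ u → adj H a u ≡ true → not ⌊ u ≟ a ⌋ ≡ true
  not-loop u au with u ≟ a
  ... | yes refl = contradiction (trans (≡-sym au) (irrefl H u)) λ ()
  ... | no _     = refl

degree≥ : ∀ {n} (H : Graph (suc (suc n))) {a y} → a ≢ y →
  (∀ u → u ≢ a → u ≢ y → adj H a u ≡ true) → n ≤ degree H a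
degree≥ {n} H {a} {y} a≢y dominates = begin
  n                        ≡⟨ countV-complement 2 a-or-y (countV-pair a≢y) ⟨
  countV (not ∘ a-or-y)    ≤⟨ countV-mono dominated ⟩
  degree H a               ∎
  where
  open ≤-Reasoning
  a-or-y : Fin (suc (suc n)) → Bool
  a-or-y u = ⌊ u ≟ a ⌋ ∨ ⌊ u ≟ y ⌋
  dominated : ∀ u → not (a-or-y u) ≡ true → adj H a u ≡ true
  dominated u _  with u ≟ a | u ≟ y
  dominated u _  | no u≢a | no u≢y = dominates u u≢a u≢y
  dominated u () | yes _  | _
  dominated u () | no _   | yes _

module Distances {n} (H : Graph n) (n>2 : 2 < n) where
  open Walks H

  dist-≤ : ∀ {k u v} → reach H k u v ≡ true → dist H u v ≤ k
  dist-≤ = least-≤ n _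

  <-dist : ∀ {k u v} → k < n → reach H k u v ≢ true → k < dist H u v
  <-dist {u = u} {v} k<n ¬uv =
    ≤-least n (λ j → reach H j u v) k<n (λ j≤k → ¬-not (¬uv ∘ reach-mono (≤⇒≤′ (≤-pred j≤k))))

  dist-self : ∀ u → dist H u u ≡ 0
  dist-self u = n≤0⇒n≡0 (dist-≤ {0} (reach-zero u))

  dist-pos : ∀ {u v} → u ≢ v → 0 < dist H u v
  dist-pos u≢v = <-dist (≤-trans (s≤s z≤n) n>2) (u≢v ∘ reach-zero⁻¹)

  dist-adj : ∀ {u v} → adj H u v ≡ true → dist H u v ≡ 1
  dist-adj {u} uv = ≤-antisym (dist-≤ {1} (reach-step {0} (reach-zero u) uv)) (dist-pos (adj⇒≢ uv))

  dist-nonadj : ∀ {u v} → u ≢ v → adj H u v ≡ false → 1 < dist H u v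
  dist-nonadj {u} {v} u≢v ¬uv = <-dist (≤-trans (s≤s (s≤s z≤n)) n>2) not-reached
    where
    not-reached : reach H 1 u v ≢ true
    not-reached r with reach-one⁻¹ r
    ... | inj₁ u≡v = u≢v u≡v
    ... | inj₂ uv  = contradiction (trans (≡-sym ¬uv) uv) λ ()

  dist≤2 : ∀ {u v} → Within₂ u v → dist H u v ≤ 2
  dist≤2 w = dist-≤ (within₂⇒reach₂ w)

  dist>2 : ∀ {u v} → ¬ Within₂ u v → 2 < dist H u v
  dist>2 ¬w = <-dist n>2 (¬w ∘ reach₂⇒within₂)

  within₂-beyond-dominating-vertex : DistanceBalanced H → ∀ {a b y} → adj H a b ≡ true → y ≢ a →
    (∀ u → u ≢ a → u ≢ y → adj H a u ≡ true) → Within₂ y a → Within₂ y b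
  within₂-beyond-dominating-vertex balanced {a} {b} {y} ab y≢a dominates ya with within₂? y b
  ... | yes yb = yb
  ... | no ¬yb = contradiction (begin
        2                                    ≡⟨ countV-pair (y≢a ∘ ≡-sym) ⟨
        countV (λ u → ⌊ u ≟ a ⌋ ∨ ⌊ u ≟ y ⌋) ≤⟨ countV-mono a,y∈Wab ⟩
        Wsize H a b                          ≡⟨ balanced a b ab ⟩
        Wsize H b a                          ≤⟨ countV-mono Wba⊆b ⟩
        countV (λ u → ⌊ u ≟ b ⌋)             ≡⟨ countV-≟ b ⟩
        1                                    ∎) 1+n≰n
    where
    open ≤-Reasoning
    y-nearer-a : dist H y a < dist H y b
    y-nearer-a = ≤-trans (s≤s (dist≤2 ya)) (dist>2 ¬yb)

    a,y∈Wab : ∀ u → (⌊ u ≟ a ⌋ ∨ ⌊ u ≟ y ⌋) ≡ true → (dist H u a <ᵇ dist H u b) ≡ true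
    a,y∈Wab u _ with u ≟ a | u ≟ y
    a,y∈Wab u _  | yes refl | _        rewrite dist-self u | dist-adj ab = refl
    a,y∈Wab u _  | no _     | yes refl = <⇒<ᵇ≡true y-nearer-a
    a,y∈Wab u () | no _     | no _

    not-nearer-b : ∀ {u} → u ≢ b → ¬ dist H u b < dist H u a
    not-nearer-b {u} u≢b with u ≟ a | u ≟ y
    ... | yes refl | _        rewrite dist-self u = λ ()
    ... | no _     | yes refl = <-asym y-nearer-a
    ... | no u≢a   | no u≢y   rewrite dist-adj (adj-sym (dominates u u≢a u≢y)) =
      λ nearer → <⇒≱ nearer (dist-pos u≢b)

    Wba⊆b : ∀ u → (dist H u b <ᵇ dist H u a) ≡ true → ⌊ u ≟ b ⌋ ≡ true
    Wba⊆b u nearer with u ≟ b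
    ... | yes _   = refl
    ... | no u≢b  = contradiction (<ᵇ≡true⇒< nearer) (not-nearer-b u≢b)

  commonNeighbour onlyNeighbour : Fin n → Fin n → Fin n → Bool
  commonNeighbour a b u = adj H a u ∧ adj H b u
  onlyNeighbour   a b u = adj H a u ∧ not (adj H b u)

  module _ (diameter≤2 : ∀ u v → dist H u v ≤ 2) where

    dist-by-adjacency : ∀ {u v} → u ≢ v → dist H u v ≡ (if adj H u v then 1 else 2)
    dist-by-adjacency {u} {v} u≢v with adj H u v in uv
    ... | true  = dist-adj uv
    ... | false = ≤-antisym (diameter≤2 u v) (dist-nonadj u≢v uv)

    Wsize-indicator : ∀ {a b} → adj H a b ≡ true → ∀ u →
      indicator (dist H u a <ᵇ dist H u b) + indicator ⌊ u ≟ b ⌋ ≡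
      indicator (onlyNeighbour a b u) + indicator ⌊ u ≟ a ⌋
    Wsize-indicator {a} {b} ab u with u ≟ a | u ≟ b
    ... | yes refl | yes refl = contradiction refl (adj⇒≢ ab)
    ... | yes refl | no _     rewrite dist-self u | dist-adj ab | irrefl H u = refl
    ... | no _     | yes refl rewrite dist-adj (adj-sym ab) | dist-self u | ab | irrefl H u = refl
    ... | no u≢a   | no u≢b
      rewrite dist-by-adjacency u≢a | dist-by-adjacency u≢b | sym H a u | sym H b u
      with adj H u a | adj H u b
    ...   | true  | true  = refl
    ...   | true  | false = refl
    ...   | false | true  = refl
    ...   | false | false = refl

    Wsize≡onlyNeighbours : ∀ {a b} → adj H a b ≡ true → Wsize H a b ≡ countV (onlyNeighbour a b)
    Wsize≡onlyNeighbours {a} {b} ab = +-cancelʳ-≡ 1 _ _ (begin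
      Wsize H a b + 1
        ≡⟨ cong (Wsize H a b +_) (countV-≟ b) ⟨
      Wsize H a b + countV (λ u → ⌊ u ≟ b ⌋)
        ≡⟨ countV-+-cong (Wsize-indicator ab) ⟩
      countV (onlyNeighbour a b) + countV (λ u → ⌊ u ≟ a ⌋)
        ≡⟨ cong (countV (onlyNeighbour a b) +_) (countV-≟ a) ⟩
      countV (onlyNeighbour a b) + 1 ∎)
      where open ≡-Reasoning

    balanced⇒adjacent-degrees-equal : DistanceBalanced H →
      ∀ {a b} → adj H a b ≡ true → degree H a ≡ degree H b
    balanced⇒adjacent-degrees-equal balanced {a} {b} ab = begin
      degree H a                                               ≡⟨ countV-split (adj H a) (adj H b) ⟨
      countV (commonNeighbour a b) + countV (onlyNeighbour a b) ≡⟨ cong₂ _+_ common-sym only-balanced ⟩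
      countV (commonNeighbour b a) + countV (onlyNeighbour b a) ≡⟨ countV-split (adj H b) (adj H a) ⟩
      degree H b                                               ∎
      where
      open ≡-Reasoning
      common-sym : countV (commonNeighbour a b) ≡ countV (commonNeighbour b a)
      common-sym = countV-cong (λ u → ∧-comm (adj H a u) (adj H b u))
      only-balanced : countV (onlyNeighbour a b) ≡ countV (onlyNeighbour b a)
      only-balanced = begin
        countV (onlyNeighbour a b) ≡⟨ Wsize≡onlyNeighbours ab ⟨
        Wsize H a b                ≡⟨ balanced a b ab ⟩
        Wsize H b a                ≡⟨ Wsize≡onlyNeighbours (adj-sym ab) ⟩
        countV (onlyNeighbour b a) ∎

foldr-⊔-≤ : ∀ {A : Set} (f : A → ℕ) {c} (xs : List A) → (∀ x → f x ≤ c) → foldr _⊔_ 0 (map f xs) ≤ c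
foldr-⊔-≤ f []       _   = z≤n
foldr-⊔-≤ f (x ∷ xs) f≤c = ⊔-lub (f≤c x) (foldr-⊔-≤ f xs f≤c)

diam≤ : ∀ {n} (H : Graph n) {k} → (∀ u v → dist H u v ≤ k) → diam H ≤ k
diam≤ {n} H dist≤k = foldr-⊔-≤ _ (allFin n) (λ u → foldr-⊔-≤ (dist H u) (allFin n) (dist≤k u))

module S21 {m} (m≥1 : 1 ≤ m) (H : Graph (suc (suc m)))
           (G⊆H : ContainsS21 H) (balanced : DistanceBalanced H) where
  open Walks H
  open Distances H (s≤s (s≤s m≥1))

  o x₁ y : Fin (suc (suc m))
  o  = zero
  x₁ = suc zero
  y  = fromℕ (suc m)

  y≢o : y ≢ o
  y≢o ()

  x₁≢y : x₁ ≢ y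
  x₁≢y x₁≡y = <⇒≢ m≥1 (trans (cong toℕ (Fin-suc-injective x₁≡y)) (toℕ-fromℕ m))

  isX-suc : ∀ {u} → suc u ≢ y → isX (suc u) ≡ true
  isX-suc {u} u≢y =
    cong (λ b → if b then false else true) (trans (isYes≗does (suc u ≟ y)) (dec-false (suc u ≟ y) u≢y))

  isY-y : isY y ≡ true
  isY-y = trans (isYes≗does (y ≟ y)) (dec-true (y ≟ y) refl)

  o-dominates : ∀ u → u ≢ o → u ≢ y → adj H o u ≡ true
  o-dominates zero    u≢o _   = contradiction refl u≢o
  o-dominates (suc u) _   u≢y = G⊆H o (suc u) (cong (_∨ _) (isX-suc u≢y))

  o-closedNeighbourhood : ∀ {u} → u ≢ y → u ≡ o ⊎ adj H o u ≡ true
  o-closedNeighbourhood {u} u≢y with u ≟ o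
  ... | yes u≡o = inj₁ u≡o
  ... | no  u≢o = inj₂ (o-dominates u u≢o u≢y)

  o~x₁ : adj H o x₁ ≡ true
  o~x₁ = o-dominates x₁ (λ ()) x₁≢y

  x₁~y : adj H x₁ y ≡ true
  x₁~y = G⊆H x₁ y
    (trans (cong (λ c → isX x₁ ∧ isO y ∨ c ∨ isY x₁ ∧ isX1 y) isY-y) (∨-zeroʳ (isX x₁ ∧ isO y)))

  y-within₂-o : Within₂ y o
  y-within₂-o = common-neighbour x₁ (adj-sym x₁~y) (adj-sym o~x₁)

  y-within₂ : ∀ v → Within₂ y v
  y-within₂ v with v ≟ y | v ≟ o
  ... | yes refl | _        = equal refl
  ... | no _     | yes refl = y-within₂-o
  ... | no v≢y   | no v≢o   =
    within₂-beyond-dominating-vertex balanced (o-dominates v v≢o v≢y) y≢o o-dominates y-within₂-o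

  within₂-all : ∀ u v → Within₂ u v
  within₂-all u v with u ≟ y | v ≟ y
  ... | yes refl | _        = y-within₂ v
  ... | no _     | yes refl = within₂-sym (y-within₂ u)
  ... | no u≢y   | no v≢y   = within₂-through (o-closedNeighbourhood u≢y) (o-closedNeighbourhood v≢y)

  diameter≤2 : ∀ u v → dist H u v ≤ 2
  diameter≤2 u v = dist≤2 (within₂-all u v)

  regular : ∀ v → degree H v ≡ degree H o
  regular v =
    degree-constant-within₂ (balanced⇒adjacent-degrees-equal diameter≤2 balanced) (within₂-all v o)

theorem3p2 : (m : ℕ) → 3 ≤ m → (H : Graph (suc (suc m))) →
    ContainsS21 H → DistanceBalanced H →
    diam H ≤ 2 × Σ ℕ (λ r → m ≤ r × r ≤ suc m × (∀ v → degree H v ≡ r))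
theorem3p2 m m≥3 H G⊆H balanced =
  diam≤ H diameter≤2 , degree H o , degree≥ H (y≢o ∘ ≡-sym) o-dominates , degree≤ H o , regular
  where open S21 (≤-trans (s≤s z≤n) m≥3) H G⊆H balanced
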